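{- Let $\mathcal C\in\{\mathrm{ID},\mathrm{CD}\}$. The contraction rules are height-preserving admissible in $\mathsf{LBIQ}(\mathcal C)$: if $\mathcal R,\mathcal T,\Gamma,w:\varphi,w:\varphi\vdash\Delta$ has a proof of height $n$, then $\mathcal R,\mathcal T,\Gamma,w:\varphi\vdash\Delta$ has a proof of height at most $n$; and if $\mathcal R,\mathcal T,\Gamma\vdash\Delta,w:\varphi,w:\varphi$ has a proof of height $n$, then $\mathcal R,\mathcal T,\Gamma\vdash\Delta,w:\varphi$ has a proof of height at most $n$ (all in $\mathsf{LBIQ}(\mathcal C)$).
   Context: Syntax. Terms from variables and function symbols (constants have arity $0$); $\mathrm{Ter}(X)$ = terms with variables in $X$ (contains all constants), $\mathrm{Ter}=\mathrm{Ter}(\mathrm{Var})$, $\mathrm{VT}(t)$ variables of $t$, $\mathrm{VT}(\vec t)=\bigcup_i\mathrm{VT}(t_i)$. Formulae: $\varphi::=p(\vec t)\mid\bot\mid\top\mid\varphi\wedge\varphi\mid\varphi\vee\varphi\mid\varphi\mathbin{ -\!\!<}\varphi\mid\varphi\to\varphi\mid\exists x\varphi\mid\forall x\varphi$ ($\mathbin{ -\!\!<}$ exclusion); $\varphi(t/x)$ capture-avoiding substitution. Sequents. Labeled formula $w:\varphi$, relational atom $wRu$, domain atom $w:x$. A sequent is $\mathcal R,\mathcal T,\Gamma\vdash\Delta$ ($\mathcal R$ finite multiset of relational atoms, $\mathcal T$ of domain atoms, $\Gamma,\Delta$ of labeled formulae) with (1) if $\mathcal R\ne\emptyset$ every label in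 $\mathcal T,\Gamma,\Delta$ occurs in $\mathcal R$, and if $\mathcal R=\emptyset$ exactly one label occurs; (2) the directed graph of $\mathcal R$ connected without directed or undirected cycles. $w\twoheadrightarrow^*_{\mathcal R}u$ iff $w=u$ or there is a chain $wRv_1,\dots,v_nRu$ in $\mathcal R$. $X_w=\{x\mid u:x\in\mathcal T,\ u\twoheadrightarrow^*_{\mathcal R}w\}$; $t$ available for $w$ iff $t\in\mathrm{Ter}(X_w)$. Fresh = not occurring in the conclusion; side conditions evaluated in the conclusion. $\mathsf{LBIQ}(\mathrm{ID})$ (premises$\,/\,$conclusion, unchanged parts omitted): (ax) $\Gamma,w:p(\vec t)\vdash\Delta,u:p(\vec t)$ if $w\twoheadrightarrow^*_{\mathcal R}u$; $(\bot L)$ $\Gamma,w:\bot\vdash\Delta$; $(\top R)$ $\Gamma\vdash\Delta,w:\top$; $(\wedge L)$ $\Gamma,w:\varphi,w:\psi\vdash\Delta\,/\,\Gamma,w:\varphi\wedge\psi\vdash\Delta$; $(\wedge R)$ $\Gamma\vdash\Delta,w:\varphi$ and $\Gamma\vdash\Delta,w:\psi\,/\,\Gamma\vdash\Delta,w:\varphi\wedge\psi$; $(\vee L)$ $\Gamma,w:\varphi\vdash\Delta$ and $\Gamma,w:\psi\vdash\Delta\,/\,\Gamma,w:\varphi\vee\psi\vdash\Delta$; $(\vee R)$ $\Gamma\vdash\Delta,w:\varphi,w:\psi\,/\,\Gamma\vdash\Delta,w:\varphi\vee\psi$; $(\to L)$ $\Gamma,w:\varphi\to\psi\vdash\Delta,u:\varphi$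 and $\Gamma,w:\varphi\to\psi,u:\psi\vdash\Delta\,/\,\Gamma,w:\varphi\to\psi\vdash\Delta$ if $w\twoheadrightarrow^*_{\mathcal R}u$; $(\to R)$ $\mathcal R,wRu,\mathcal T,\Gamma,u:\varphi\vdash\Delta,u:\psi\,/\,\mathcal R,\mathcal T,\Gamma\vdash\Delta,w:\varphi\to\psi$, $u$ fresh; $(\mathbin{ -\!\!<}L)$ $\mathcal R,uRw,\mathcal T,\Gamma,u:\varphi\vdash\Delta,u:\psi\,/\,\mathcal R,\mathcal T,\Gamma,w:\varphi\mathbin{ -\!\!<}\psi\vdash\Delta$, $u$ fresh; $(\mathbin{ -\!\!<}R)$ $\Gamma\vdash\Delta,u:\varphi\mathbin{ -\!\!<}\psi,w:\varphi$ and $\Gamma,w:\psi\vdash\Delta,u:\varphi\mathbin{ -\!\!<}\psi\,/\,\Gamma\vdash\Delta,u:\varphi\mathbin{ -\!\!<}\psi$ if $w\twoheadrightarrow^*_{\mathcal R}u$; $(\exists L)$ $\mathcal R,\mathcal T,w:y,\Gamma,w:\varphi(y/x)\vdash\Delta\,/\,\mathcal R,\mathcal T,\Gamma,w:\exists x\varphi\vdash\Delta$, $y$ fresh; $(\exists R)$ $\Gamma\vdash\Delta,w:\exists x\varphi,w:\varphi(t/x)\,/\,\Gamma\vdash\Delta,w:\exists x\varphi$ if $t$ available for $w$; $(\forall L)$ $\Gamma,w:\forall x\varphi,u:\varphi(t/x)\vdash\Delta\,/\,\Gamma,w:\forall x\varphi\vdash\Delta$ if $w\twoheadrightarrow^*_{\mathcal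 R}u$ and $t$ available for $u$; $(\forall R)$ $\mathcal R,wRu,\mathcal T,u:y,\Gamma\vdash\Delta,u:\varphi(y/x)\,/\,\mathcal R,\mathcal T,\Gamma\vdash\Delta,w:\forall x\varphi$, $u,y$ fresh; $(ds)$ $\mathcal R,\mathcal T,w:\mathrm{VT}(\vec t),\Gamma,w:p(\vec t)\vdash\Delta\,/\,\mathcal R,\mathcal T,\Gamma,w:p(\vec t)\vdash\Delta$. $\mathsf{LBIQ}(\mathrm{CD})$: remove $(ds)$, allow any $t\in\mathrm{Ter}$ in $(\exists R)$ and $(\forall L)$ (keeping $w\twoheadrightarrow^*_{\mathcal R}u$ in $(\forall L)$). Proofs are finite trees of rule instances with leaves (ax), $(\bot L)$, $(\top R)$; height = length of the longest branch. Sequents differing by a bijective label renaming are regarded as mutually derivable. -}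

module Defs where

open import Data.Nat using (ℕ; zero; suc; _⊔_)
open import Data.Nat.Properties using (_≟_)
open import Data.Fin using (Fin; zero; suc)
open import Data.List using (List; []; _∷_; _++_; map; concatMap; length; lookup; deduplicate)
open import Data.List.Membership.Propositional using (_∈_; _∉_)
open import Data.List.Relation.Unary.All using (All)
open import Data.List.Relation.Unary.Unique.Propositional using (Unique)
open import Data.List.Relation.Binary.Permutation.Propositional using (_↭_)
open import Data.Product using (Σ; ∃; ∃-syntax; _×_; _,_; proj₁; proj₂)
open import Data.Sum using (_⊎_)
open import Data.Unit using (⊤)
open import Relation.Binary.PropositionalEquality using (_≡_; _≢_)

-- Syntax (locally nameless, bound variables as de Bruijn *levels*,
-- intrinsically scoped: Term n / Form n have n bound variables in scope)

Var : Set
Var = ℕ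

Label : Set
Label = ℕ

-- function symbols f applied to a list of k arguments: the symbol is
-- the pair (f, k), so every arity has countably many symbols; constants
-- are symbols applied to [].
FunSym : Set
FunSym = ℕ

PredSym : Set
PredSym = ℕ

data Term (n : ℕ) : Set where
  var  : Var → Term n
  bvar : Fin n → Term n
  fun  : FunSym → List (Term n) → Term n

Ter : Set
Ter = Term 0

data Form (n : ℕ) : Set where
  atom : PredSym → List (Term n) → Form n
  ⊥ᶠ ⊤ᶠ : Form n
  _∧ᶠ_ _∨ᶠ_ _−<_ _⇒_ : Form n → Form n → Form n
  ∃ᶠ ∀ᶠ : Form (suc n) → Form n     -- ∃x φ , ∀x φ  (x = level n)

mutual
  emb : ∀ {n} → Ter → Term n
  emb (var x) = var x
  emb (bvar ())
  emb (fun f ts) = fun f (embs ts)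

  embs : ∀ {n} → List Ter → List (Term n)
  embs [] = []
  embs (t ∷ ts) = emb t ∷ embs ts

-- instantiate the outermost bound variable (level 0) by a term t
mutual
  instT : ∀ {n} → Ter → Term (suc n) → Term n
  instT t (var x) = var x
  instT t (bvar zero) = emb t
  instT t (bvar (suc i)) = bvar i
  instT t (fun f ts) = fun f (instTs t ts)

  instTs : ∀ {n} → Ter → List (Term (suc n)) → List (Term n)
  instTs t [] = []
  instTs t (s ∷ ss) = instT t s ∷ instTs t ss

inst : ∀ {n} → Ter → Form (suc n) → Form n
inst t (atom p ts) = atom p (instTs t ts)
inst t ⊥ᶠ = ⊥ᶠ
inst t ⊤ᶠ = ⊤ᶠ
inst t (φ ∧ᶠ ψ) = inst t φ ∧ᶠ inst t ψ
inst t (φ ∨ᶠ ψ) = inst t φ ∨ᶠ inst t ψ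
inst t (φ −< ψ) = inst t φ −< inst t ψ
inst t (φ ⇒ ψ) = inst t φ ⇒ inst t ψ
inst t (∃ᶠ φ) = ∃ᶠ (inst t φ)
inst t (∀ᶠ φ) = ∀ᶠ (inst t φ)

mutual
  fvT : ∀ {n} → Term n → List Var
  fvT (var x) = x ∷ []
  fvT (bvar i) = []
  fvT (fun f ts) = fvTs ts

  fvTs : ∀ {n} → List (Term n) → List Var
  fvTs [] = []
  fvTs (t ∷ ts) = fvT t ++ fvTs ts

fvF : ∀ {n} → Form n → List Var
fvF (atom p ts) = fvTs ts
fvF ⊥ᶠ = []
fvF ⊤ᶠ = []
fvF (φ ∧ᶠ ψ) = fvF φ ++ fvF ψ
fvF (φ ∨ᶠ ψ) = fvF φ ++ fvF ψ
fvF (φ −< ψ) = fvF φ ++ fvF ψ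
fvF (φ ⇒ ψ) = fvF φ ++ fvF ψ
fvF (∃ᶠ φ) = fvF φ
fvF (∀ᶠ φ) = fvF φ

VT : List Ter → List Var
VT ts = deduplicate _≟_ (fvTs ts)

-- Sequents  R , T , Γ ⊢ Δ  (multisets represented by lists; all rules
-- below are applicable up to permutation, so order is irrelevant)

LForm : Set
LForm = Label × Form 0

RelAtoms : Set
RelAtoms = List (Label × Label)      -- (w , u)  stands for  wRu

DomAtoms : Set
DomAtoms = List (Label × Var)        -- (w , x)  stands for  w:x

infix 4 _∣_∣_⊢_

record Sequent : Set where
  constructor _∣_∣_⊢_
  field
    rel  : RelAtoms
    dom  : DomAtoms
    ante : List LForm
    succ : List LForm

data Reach (R : RelAtoms) : Label → Label → Set where
  here : ∀ {w} → Reach R w w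
  step : ∀ {w v u} → (w , v) ∈ R → Reach R v u → Reach R w u

InX : RelAtoms → DomAtoms → Var → Label → Set
InX R T x w = ∃[ u ] ((u , x) ∈ T × Reach R u w)

Available : RelAtoms → DomAtoms → Ter → Label → Set
Available R T t w = All (λ x → InX R T x w) (fvT t)

labelsR : RelAtoms → List Label
labelsR = concatMap (λ e → proj₁ e ∷ proj₂ e ∷ [])

labelsTΓΔ : Sequent → List Label
labelsTΓΔ (R ∣ T ∣ Γ ⊢ Δ) = map proj₁ T ++ map proj₁ Γ ++ map proj₁ Δ

labels : Sequent → List Label
labels S = labelsR (Sequent.rel S) ++ labelsTΓΔ S

vars : Sequent → List Var
vars (R ∣ T ∣ Γ ⊢ Δ) = map proj₂ T ++ concatMap (λ a → fvF (proj₂ a)) (Γ ++ Δ)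

FreshL : Label → Sequent → Set
FreshL u S = u ∉ labels S

FreshV : Var → Sequent → Set
FreshV y S = y ∉ vars S

Link : Label × Label → Label → Label → Set
Link (a , b) v v' = (a ≡ v × b ≡ v') ⊎ (b ≡ v × a ≡ v')

data Walk (R : RelAtoms) : Label → Label → List (Fin (length R)) → Set where
  []  : ∀ {v} → Walk R v v []
  _∷_ : ∀ {v v' u i is} → Link (lookup R i) v v' → Walk R v' u is → Walk R v u (i ∷ is)

Connected : RelAtoms → Set
Connected R = ∀ v v' → v ∈ labelsR R → v' ∈ labelsR R → ∃[ is ] Walk R v v' is

-- no (directed or undirected) cycle: every closed walk that does not
-- repeat an edge occurrence is empty
Acyclic : RelAtoms → Set
Acyclic R = ∀ v is → Walk R v v is → Unique is → is ≡ []

WF : Sequent → Set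
WF S =
  (Sequent.rel S ≢ [] → All (λ l → l ∈ labelsR (Sequent.rel S)) (labelsTΓΔ S))
  × (Sequent.rel S ≡ [] → ∃[ w ] (w ∈ labelsTΓΔ S × All (λ l → l ≡ w) (labelsTΓΔ S)))
  × Connected (Sequent.rel S)
  × Acyclic (Sequent.rel S)

data Cond : Set where
  ID CD : Cond

TermOK : Cond → RelAtoms → DomAtoms → Ter → Label → Set
TermOK ID R T t w = Available R T t w
TermOK CD R T t w = ⊤

data Der (C : Cond) : Sequent → Set where
  ax : ∀ {R T Γ Δ w u p ts} →
       (w , atom p ts) ∈ Γ → (u , atom p ts) ∈ Δ → Reach R w u →
       Der C (R ∣ T ∣ Γ ⊢ Δ)
  ⊥L : ∀ {R T Γ Δ w} → (w , ⊥ᶠ) ∈ Γ → Der C (R ∣ T ∣ Γ ⊢ Δ)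
  ⊤R : ∀ {R T Γ Δ w} → (w , ⊤ᶠ) ∈ Δ → Der C (R ∣ T ∣ Γ ⊢ Δ)
  ∧L : ∀ {R T Γ Γ' Δ w φ ψ} → Γ ↭ (w , φ ∧ᶠ ψ) ∷ Γ' →
       Der C (R ∣ T ∣ (w , φ) ∷ (w , ψ) ∷ Γ' ⊢ Δ) →
       Der C (R ∣ T ∣ Γ ⊢ Δ)
  ∧R : ∀ {R T Γ Δ Δ' w φ ψ} → Δ ↭ (w , φ ∧ᶠ ψ) ∷ Δ' →
       Der C (R ∣ T ∣ Γ ⊢ (w , φ) ∷ Δ') →
       Der C (R ∣ T ∣ Γ ⊢ (w , ψ) ∷ Δ') →
       Der C (R ∣ T ∣ Γ ⊢ Δ)
  ∨L : ∀ {R T Γ Γ' Δ w φ ψ} → Γ ↭ (w , φ ∨ᶠ ψ) ∷ Γ' →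
       Der C (R ∣ T ∣ (w , φ) ∷ Γ' ⊢ Δ) →
       Der C (R ∣ T ∣ (w , ψ) ∷ Γ' ⊢ Δ) →
       Der C (R ∣ T ∣ Γ ⊢ Δ)
  ∨R : ∀ {R T Γ Δ Δ' w φ ψ} → Δ ↭ (w , φ ∨ᶠ ψ) ∷ Δ' →
       Der C (R ∣ T ∣ Γ ⊢ (w , φ) ∷ (w , ψ) ∷ Δ') →
       Der C (R ∣ T ∣ Γ ⊢ Δ)
  ⇒L : ∀ {R T Γ Δ w u φ ψ} → (w , φ ⇒ ψ) ∈ Γ → Reach R w u →
       Der C (R ∣ T ∣ Γ ⊢ (u , φ) ∷ Δ) →
       Der C (R ∣ T ∣ (u , ψ) ∷ Γ ⊢ Δ) →
       Der C (R ∣ T ∣ Γ ⊢ Δ)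
  ⇒R : ∀ {R T Γ Δ Δ' w u φ ψ} → Δ ↭ (w , φ ⇒ ψ) ∷ Δ' →
       FreshL u (R ∣ T ∣ Γ ⊢ Δ) →
       Der C ((w , u) ∷ R ∣ T ∣ (u , φ) ∷ Γ ⊢ (u , ψ) ∷ Δ') →
       Der C (R ∣ T ∣ Γ ⊢ Δ)
  −<L : ∀ {R T Γ Γ' Δ w u φ ψ} → Γ ↭ (w , φ −< ψ) ∷ Γ' →
       FreshL u (R ∣ T ∣ Γ ⊢ Δ) →
       Der C ((u , w) ∷ R ∣ T ∣ (u , φ) ∷ Γ' ⊢ (u , ψ) ∷ Δ) →
       Der C (R ∣ T ∣ Γ ⊢ Δ)
  −<R : ∀ {R T Γ Δ w u φ ψ} → (u , φ −< ψ) ∈ Δ → Reach R w u →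
       Der C (R ∣ T ∣ Γ ⊢ (w , φ) ∷ Δ) →
       Der C (R ∣ T ∣ (w , ψ) ∷ Γ ⊢ Δ) →
       Der C (R ∣ T ∣ Γ ⊢ Δ)
  ∃L : ∀ {R T Γ Γ' Δ w y φ} → Γ ↭ (w , ∃ᶠ φ) ∷ Γ' →
       FreshV y (R ∣ T ∣ Γ ⊢ Δ) →
       Der C (R ∣ (w , y) ∷ T ∣ (w , inst (var y) φ) ∷ Γ' ⊢ Δ) →
       Der C (R ∣ T ∣ Γ ⊢ Δ)
  ∃R : ∀ {R T Γ Δ w φ} (t : Ter) → (w , ∃ᶠ φ) ∈ Δ → TermOK C R T t w →
       Der C (R ∣ T ∣ Γ ⊢ (w , inst t φ) ∷ Δ) →
       Der C (R ∣ T ∣ Γ ⊢ Δ)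
  ∀L : ∀ {R T Γ Δ w u φ} (t : Ter) → (w , ∀ᶠ φ) ∈ Γ → Reach R w u →
       TermOK C R T t u →
       Der C (R ∣ T ∣ (u , inst t φ) ∷ Γ ⊢ Δ) →
       Der C (R ∣ T ∣ Γ ⊢ Δ)
  ∀R : ∀ {R T Γ Δ Δ' w u y φ} → Δ ↭ (w , ∀ᶠ φ) ∷ Δ' →
       FreshL u (R ∣ T ∣ Γ ⊢ Δ) → FreshV y (R ∣ T ∣ Γ ⊢ Δ) →
       Der C ((w , u) ∷ R ∣ (u , y) ∷ T ∣ Γ ⊢ (u , inst (var y) φ) ∷ Δ') →
       Der C (R ∣ T ∣ Γ ⊢ Δ)
  ds : ∀ {R T Γ Δ w p ts} → C ≡ ID → (w , atom p ts) ∈ Γ →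
       Der C (R ∣ map (λ x → (w , x)) (VT ts) ++ T ∣ Γ ⊢ Δ) →
       Der C (R ∣ T ∣ Γ ⊢ Δ)

height : ∀ {C S} → Der C S → ℕ
height (ax _ _ _) = 0
height (⊥L _) = 0
height (⊤R _) = 0
height (∧L _ d) = suc (height d)
height (∧R _ d e) = suc (height d ⊔ height e)
height (∨L _ d e) = suc (height d ⊔ height e)
height (∨R _ d) = suc (height d)
height (⇒L _ _ d e) = suc (height d ⊔ height e)
height (⇒R _ _ d) = suc (height d)
height (−<L _ _ d) = suc (height d)
height (−<R _ _ d e) = suc (height d ⊔ height e)
height (∃L _ _ d) = suc (height d)
height (∃R _ _ _ d) = suc (height d)
height (∀L _ _ _ _ d) = suc (height d)
height (∀R _ _ _ d) = suc (height d)
height (ds _ _ d) = suc (height d)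

-- Contraction is an instance of a height-preserving transfer principle. Call a labelled formula
-- covered by a sequent if it occurs in it, or if the components that the rule decomposing it would
-- add are already covered (an existing relational or domain atom standing in for the eigenlabel or
-- eigenvariable). A derivation of S can then be replayed, by induction, in any sequent S₂ into which
-- S maps by renamings of labels and variables sending atoms to atoms and formulas to covered
-- formulas: a rule whose principal formula occurs in S₂ is applied there, with fresh eigennames
-- recorded by updating the renamings, while a rule whose principal formula is only covered is
-- skipped. Neither step increases the height. Since X, X, Γ ⊢ Δ maps into X, Γ ⊢ Δ by the identity,
-- contraction follows.

module Submission where

open import Defs
open import Data.Nat using (ℕ; suc; _≤_; _⊔_; z≤n; s≤s)
open import Data.Nat.Properties using (_≟_; ≤-trans; n≤1+n; m≤n⇒m≤1+n; ⊔-mono-≤; m≤m⊔n; m≤n⊔m; 1+n≰n)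
open import Data.List using (List; []; _∷_; _++_; map; concatMap)
open import Data.List.Properties using (map-++)
open import Data.List.Extrema.Nat using (max; xs≤max)
open import Data.List.Membership.Propositional using (_∈_; _∉_)
open import Data.List.Membership.Propositional.Properties
  using (∈-++⁺ˡ; ∈-++⁺ʳ; ∈-++⁻; ∈-map⁺; ∈-map⁻; ∈-∃++; ∈-concatMap⁺; ∈-deduplicate⁺; ∈-deduplicate⁻)
open import Data.List.Relation.Binary.Subset.Propositional using (_⊆_)
open import Data.List.Relation.Unary.Any as Any using (here; there)
open import Data.List.Relation.Unary.All as All using (All)
open import Data.List.Relation.Unary.All.Properties using (map⁺)
open import Data.List.Relation.Binary.Permutation.Propositional using (_↭_; ↭-sym)
open import Data.List.Relation.Binary.Permutation.Propositional.Properties using (∈-resp-↭; shift)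
open import Data.Product using (Σ; Σ-syntax; ∃; _×_; _,_; proj₁; proj₂)
open import Data.Sum using ([_,_]′)
open import Data.Unit using (tt)
open import Data.Fin using () renaming (zero to fzero; suc to fsuc)
open import Function using (id; _∘_)
open import Relation.Nullary using (yes; no; contradiction)
open import Relation.Binary.PropositionalEquality
  using (_≡_; _≢_; refl; sym; trans; cong; cong₂; subst; subst₂)

private variable
  n m : ℕ
  C : Cond
  R R₂ : RelAtoms
  T T' : DomAtoms
  Γ Γ' Δ Δ' : List LForm
  S S' S₂ S₃ : Sequent
  X : LForm
  φ ψ : Form 0
  w u v : Label
  x y z : Var
  σ σ' : Label → Label
  τ τ' : Var → Var

mutual
  renameᵗ : ∀ {k} → (Var → Var) → Term k → Term k
  renameᵗ τ (var x) = var (τ x)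
  renameᵗ τ (bvar i) = bvar i
  renameᵗ τ (fun f ts) = fun f (renameᵗˢ τ ts)

  renameᵗˢ : ∀ {k} → (Var → Var) → List (Term k) → List (Term k)
  renameᵗˢ τ [] = []
  renameᵗˢ τ (t ∷ ts) = renameᵗ τ t ∷ renameᵗˢ τ ts

rename : ∀ {k} → (Var → Var) → Form k → Form k
rename τ (atom p ts) = atom p (renameᵗˢ τ ts)
rename τ ⊥ᶠ = ⊥ᶠ
rename τ ⊤ᶠ = ⊤ᶠ
rename τ (φ ∧ᶠ ψ) = rename τ φ ∧ᶠ rename τ ψ
rename τ (φ ∨ᶠ ψ) = rename τ φ ∨ᶠ rename τ ψ
rename τ (φ −< ψ) = rename τ φ −< rename τ ψ
rename τ (φ ⇒ ψ) = rename τ φ ⇒ rename τ ψ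
rename τ (∃ᶠ φ) = ∃ᶠ (rename τ φ)
rename τ (∀ᶠ φ) = ∀ᶠ (rename τ φ)

mutual
  renameᵗ-emb : ∀ {k} τ (t : Ter) → renameᵗ {k} τ (emb t) ≡ emb (renameᵗ τ t)
  renameᵗ-emb τ (var x) = refl
  renameᵗ-emb τ (fun f ts) = cong (fun f) (renameᵗˢ-embs τ ts)

  renameᵗˢ-embs : ∀ {k} τ (ts : List Ter) → renameᵗˢ {k} τ (embs ts) ≡ embs (renameᵗˢ τ ts)
  renameᵗˢ-embs τ [] = refl
  renameᵗˢ-embs τ (t ∷ ts) = cong₂ _∷_ (renameᵗ-emb τ t) (renameᵗˢ-embs τ ts)

mutual
  renameᵗ-instT : ∀ {k} τ (t : Ter) (s : Term (suc k)) →
                  renameᵗ τ (instT t s) ≡ instT (renameᵗ τ t) (renameᵗ τ s)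
  renameᵗ-instT τ t (var x) = refl
  renameᵗ-instT τ t (bvar fzero) = renameᵗ-emb τ t
  renameᵗ-instT τ t (bvar (fsuc i)) = refl
  renameᵗ-instT τ t (fun f ss) = cong (fun f) (renameᵗˢ-instTs τ t ss)

  renameᵗˢ-instTs : ∀ {k} τ (t : Ter) (ss : List (Term (suc k))) →
                    renameᵗˢ τ (instTs t ss) ≡ instTs (renameᵗ τ t) (renameᵗˢ τ ss)
  renameᵗˢ-instTs τ t [] = refl
  renameᵗˢ-instTs τ t (s ∷ ss) = cong₂ _∷_ (renameᵗ-instT τ t s) (renameᵗˢ-instTs τ t ss)

rename-inst : ∀ {k} τ (t : Ter) (φ : Form (suc k)) → rename τ (inst t φ) ≡ inst (renameᵗ τ t) (rename τ φ)
rename-inst τ t (atom p ts) = cong (atom p) (renameᵗˢ-instTs τ t ts)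
rename-inst τ t ⊥ᶠ = refl
rename-inst τ t ⊤ᶠ = refl
rename-inst τ t (φ ∧ᶠ ψ) = cong₂ _∧ᶠ_ (rename-inst τ t φ) (rename-inst τ t ψ)
rename-inst τ t (φ ∨ᶠ ψ) = cong₂ _∨ᶠ_ (rename-inst τ t φ) (rename-inst τ t ψ)
rename-inst τ t (φ −< ψ) = cong₂ _−<_ (rename-inst τ t φ) (rename-inst τ t ψ)
rename-inst τ t (φ ⇒ ψ) = cong₂ _⇒_ (rename-inst τ t φ) (rename-inst τ t ψ)
rename-inst τ t (∃ᶠ φ) = cong ∃ᶠ (rename-inst τ t φ)
rename-inst τ t (∀ᶠ φ) = cong ∀ᶠ (rename-inst τ t φ)

mutual
  renameᵗ-cong : ∀ {k} (t : Term k) → (∀ {x} → x ∈ fvT t → τ x ≡ τ' x) → renameᵗ τ t ≡ renameᵗ τ' t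
  renameᵗ-cong (var x) eq = cong var (eq (here refl))
  renameᵗ-cong (bvar i) eq = refl
  renameᵗ-cong (fun f ts) eq = cong (fun f) (renameᵗˢ-cong ts eq)

  renameᵗˢ-cong : ∀ {k} (ts : List (Term k)) → (∀ {x} → x ∈ fvTs ts → τ x ≡ τ' x) →
                  renameᵗˢ τ ts ≡ renameᵗˢ τ' ts
  renameᵗˢ-cong [] eq = refl
  renameᵗˢ-cong (t ∷ ts) eq =
    cong₂ _∷_ (renameᵗ-cong t (eq ∘ ∈-++⁺ˡ)) (renameᵗˢ-cong ts (eq ∘ ∈-++⁺ʳ (fvT t)))

rename-cong : ∀ {k} (φ : Form k) → (∀ {x} → x ∈ fvF φ → τ x ≡ τ' x) → rename τ φ ≡ rename τ' φ
rename-cong (atom p ts) eq = cong (atom p) (renameᵗˢ-cong ts eq)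
rename-cong ⊥ᶠ eq = refl
rename-cong ⊤ᶠ eq = refl
rename-cong (φ ∧ᶠ ψ) eq = cong₂ _∧ᶠ_ (rename-cong φ (eq ∘ ∈-++⁺ˡ)) (rename-cong ψ (eq ∘ ∈-++⁺ʳ (fvF φ)))
rename-cong (φ ∨ᶠ ψ) eq = cong₂ _∨ᶠ_ (rename-cong φ (eq ∘ ∈-++⁺ˡ)) (rename-cong ψ (eq ∘ ∈-++⁺ʳ (fvF φ)))
rename-cong (φ −< ψ) eq = cong₂ _−<_ (rename-cong φ (eq ∘ ∈-++⁺ˡ)) (rename-cong ψ (eq ∘ ∈-++⁺ʳ (fvF φ)))
rename-cong (φ ⇒ ψ) eq = cong₂ _⇒_ (rename-cong φ (eq ∘ ∈-++⁺ˡ)) (rename-cong ψ (eq ∘ ∈-++⁺ʳ (fvF φ)))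
rename-cong (∃ᶠ φ) eq = cong ∃ᶠ (rename-cong φ eq)
rename-cong (∀ᶠ φ) eq = cong ∀ᶠ (rename-cong φ eq)

mutual
  renameᵗ-id : ∀ {k} (t : Term k) → renameᵗ id t ≡ t
  renameᵗ-id (var x) = refl
  renameᵗ-id (bvar i) = refl
  renameᵗ-id (fun f ts) = cong (fun f) (renameᵗˢ-id ts)

  renameᵗˢ-id : ∀ {k} (ts : List (Term k)) → renameᵗˢ id ts ≡ ts
  renameᵗˢ-id [] = refl
  renameᵗˢ-id (t ∷ ts) = cong₂ _∷_ (renameᵗ-id t) (renameᵗˢ-id ts)

rename-id : ∀ {k} (φ : Form k) → rename id φ ≡ φ
rename-id (atom p ts) = cong (atom p) (renameᵗˢ-id ts)
rename-id ⊥ᶠ = refl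
rename-id ⊤ᶠ = refl
rename-id (φ ∧ᶠ ψ) = cong₂ _∧ᶠ_ (rename-id φ) (rename-id ψ)
rename-id (φ ∨ᶠ ψ) = cong₂ _∨ᶠ_ (rename-id φ) (rename-id ψ)
rename-id (φ −< ψ) = cong₂ _−<_ (rename-id φ) (rename-id ψ)
rename-id (φ ⇒ ψ) = cong₂ _⇒_ (rename-id φ) (rename-id ψ)
rename-id (∃ᶠ φ) = cong ∃ᶠ (rename-id φ)
rename-id (∀ᶠ φ) = cong ∀ᶠ (rename-id φ)

mutual
  fvT-renameᵗ : ∀ {k} τ (t : Term k) → fvT (renameᵗ τ t) ≡ map τ (fvT t)
  fvT-renameᵗ τ (var x) = refl
  fvT-renameᵗ τ (bvar i) = refl
  fvT-renameᵗ τ (fun f ts) = fvTs-renameᵗˢ τ ts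

  fvTs-renameᵗˢ : ∀ {k} τ (ts : List (Term k)) → fvTs (renameᵗˢ τ ts) ≡ map τ (fvTs ts)
  fvTs-renameᵗˢ τ [] = refl
  fvTs-renameᵗˢ τ (t ∷ ts) =
    trans (cong₂ _++_ (fvT-renameᵗ τ t) (fvTs-renameᵗˢ τ ts)) (sym (map-++ τ (fvT t) (fvTs ts)))

VT-rename : ∀ ts → x ∈ VT ts → τ x ∈ VT (renameᵗˢ τ ts)
VT-rename {τ = τ} ts p =
  ∈-deduplicate⁺ _≟_ (subst (_ ∈_) (sym (fvTs-renameᵗˢ τ ts)) (∈-map⁺ τ (∈-deduplicate⁻ _≟_ (fvTs ts) p)))

∈∧∉⇒≢ : ∀ {A : Set} {a b : A} {xs} → a ∈ xs → b ∉ xs → a ≢ b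
∈∧∉⇒≢ a∈xs b∉xs refl = b∉xs a∈xs

_[_↦_] : (ℕ → ℕ) → ℕ → ℕ → ℕ → ℕ
(f [ a ↦ b ]) c with c ≟ a
... | yes _ = b
... | no _ = f c

[↦]-≡ : ∀ f a b → (f [ a ↦ b ]) a ≡ b
[↦]-≡ f a b with a ≟ a
... | yes _ = refl
... | no a≢a = contradiction refl a≢a

[↦]-≢ : ∀ f {a} b {c} → c ≢ a → (f [ a ↦ b ]) c ≡ f c
[↦]-≢ f {a} b {c} c≢a with c ≟ a
... | yes c≡a = contradiction c≡a c≢a
... | no _ = refl

rename-inst-[↦] : ∀ {k} (φ : Form (suc k)) → y ∉ fvF φ →
                  rename (τ [ y ↦ z ]) (inst (var y) φ) ≡ inst (var z) (rename τ φ)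
rename-inst-[↦] {y = y} {τ = τ} {z = z} φ y∉φ =
  trans (rename-inst (τ [ y ↦ z ]) (var y) φ)
        (cong₂ inst (cong var ([↦]-≡ τ y z)) (rename-cong φ (λ x∈φ → [↦]-≢ τ z (∈∧∉⇒≢ x∈φ y∉φ))))

fresh : List ℕ → ℕ
fresh xs = suc (max 0 xs)

fresh-∉ : ∀ xs → fresh xs ∉ xs
fresh-∉ xs p = 1+n≰n (All.lookup (xs≤max 0 xs) p)

∈-concatMap : ∀ {A B : Set} (f : A → List B) {a b xs} → b ∈ f a → a ∈ xs → b ∈ concatMap f xs
∈-concatMap f b∈fa a∈xs = ∈-concatMap⁺ f (Any.map (λ { refl → b∈fa }) a∈xs)

module _ (S : Sequent) where
  open Sequent S

  rel-labelˡ : ∀ {a b} → (a , b) ∈ rel → a ∈ labels S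
  rel-labelˡ p = ∈-++⁺ˡ (∈-concatMap _ (here refl) p)

  rel-labelʳ : ∀ {a b} → (a , b) ∈ rel → b ∈ labels S
  rel-labelʳ p = ∈-++⁺ˡ (∈-concatMap _ (there (here refl)) p)

  dom-label : ∀ {l x} → (l , x) ∈ dom → l ∈ labels S
  dom-label p = ∈-++⁺ʳ (labelsR rel) (∈-++⁺ˡ (∈-map⁺ proj₁ p))

  ante-label : ∀ {l φ} → (l , φ) ∈ ante → l ∈ labels S
  ante-label p = ∈-++⁺ʳ (labelsR rel) (∈-++⁺ʳ (map proj₁ dom) (∈-++⁺ˡ (∈-map⁺ proj₁ p)))

  succ-label : ∀ {l φ} → (l , φ) ∈ succ → l ∈ labels S
  succ-label p = ∈-++⁺ʳ (labelsR rel) (∈-++⁺ʳ (map proj₁ dom) (∈-++⁺ʳ (map proj₁ ante) (∈-map⁺ proj₁ p)))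

  dom-var : ∀ {l x} → (l , x) ∈ dom → x ∈ vars S
  dom-var p = ∈-++⁺ˡ (∈-map⁺ proj₂ p)

  ante-var : ∀ {l φ x} → (l , φ) ∈ ante → x ∈ fvF φ → x ∈ vars S
  ante-var p q = ∈-++⁺ʳ (map proj₂ dom) (∈-concatMap _ q (∈-++⁺ˡ p))

  succ-var : ∀ {l φ x} → (l , φ) ∈ succ → x ∈ fvF φ → x ∈ vars S
  succ-var p q = ∈-++⁺ʳ (map proj₂ dom) (∈-concatMap _ q (∈-++⁺ʳ ante p))

↭-head : ∀ {A : Set} {a : A} {xs ys} → xs ↭ a ∷ ys → a ∈ xs
↭-head pm = ∈-resp-↭ (↭-sym pm) (here refl)

∈⇒↭ : ∀ {A : Set} {a : A} {xs} → a ∈ xs → ∃ λ ys → xs ↭ a ∷ ys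
∈⇒↭ {a = a} p with ys , zs , refl ← ∈-∃++ p = ys ++ zs , shift a ys zs

mutual
  data Coveredᴸ (S : Sequent) : LForm → Set where
    ∈ᴸ  : X ∈ Sequent.ante S → Coveredᴸ S X
    ∧ᴸ  : ∀ {φ ψ} → Coveredᴸ S (w , φ) → Coveredᴸ S (w , ψ) → Coveredᴸ S (w , φ ∧ᶠ ψ)
    ∨ᴸ₁ : ∀ {φ ψ} → Coveredᴸ S (w , φ) → Coveredᴸ S (w , φ ∨ᶠ ψ)
    ∨ᴸ₂ : ∀ {φ ψ} → Coveredᴸ S (w , ψ) → Coveredᴸ S (w , φ ∨ᶠ ψ)
    −<ᴸ : ∀ {φ ψ} → (v , w) ∈ Sequent.rel S → Coveredᴸ S (v , φ) → Coveredᴿ S (v , ψ) →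
          Coveredᴸ S (w , φ −< ψ)
    ∃ᴸ  : ∀ {φ} → (w , y) ∈ Sequent.dom S → Coveredᴸ S (w , inst (var y) φ) → Coveredᴸ S (w , ∃ᶠ φ)

  data Coveredᴿ (S : Sequent) : LForm → Set where
    ∈ᴿ  : X ∈ Sequent.succ S → Coveredᴿ S X
    ∧ᴿ₁ : ∀ {φ ψ} → Coveredᴿ S (w , φ) → Coveredᴿ S (w , φ ∧ᶠ ψ)
    ∧ᴿ₂ : ∀ {φ ψ} → Coveredᴿ S (w , ψ) → Coveredᴿ S (w , φ ∧ᶠ ψ)
    ∨ᴿ  : ∀ {φ ψ} → Coveredᴿ S (w , φ) → Coveredᴿ S (w , ψ) → Coveredᴿ S (w , φ ∨ᶠ ψ)
    ⇒ᴿ  : ∀ {φ ψ} → (w , v) ∈ Sequent.rel S → Coveredᴸ S (v , φ) → Coveredᴿ S (v , ψ) →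
          Coveredᴿ S (w , φ ⇒ ψ)
    ∀ᴿ  : ∀ {φ} → (w , v) ∈ Sequent.rel S → (v , y) ∈ Sequent.dom S → Coveredᴿ S (v , inst (var y) φ) →
          Coveredᴿ S (w , ∀ᶠ φ)

infix 4 _≼_

record _≼_ (S S' : Sequent) : Set where
  field
    rel⊆ : Sequent.rel S ⊆ Sequent.rel S'
    dom⊆ : Sequent.dom S ⊆ Sequent.dom S'
    ante≼ : X ∈ Sequent.ante S → Coveredᴸ S' X
    succ≼ : X ∈ Sequent.succ S → Coveredᴿ S' X
open _≼_

mutual
  Coveredᴸ-≼ : S ≼ S' → Coveredᴸ S X → Coveredᴸ S' X
  Coveredᴸ-≼ I (∈ᴸ p) = ante≼ I p
  Coveredᴸ-≼ I (∧ᴸ a b) = ∧ᴸ (Coveredᴸ-≼ I a) (Coveredᴸ-≼ I b)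
  Coveredᴸ-≼ I (∨ᴸ₁ a) = ∨ᴸ₁ (Coveredᴸ-≼ I a)
  Coveredᴸ-≼ I (∨ᴸ₂ a) = ∨ᴸ₂ (Coveredᴸ-≼ I a)
  Coveredᴸ-≼ I (−<ᴸ e a b) = −<ᴸ (rel⊆ I e) (Coveredᴸ-≼ I a) (Coveredᴿ-≼ I b)
  Coveredᴸ-≼ I (∃ᴸ e a) = ∃ᴸ (dom⊆ I e) (Coveredᴸ-≼ I a)

  Coveredᴿ-≼ : S ≼ S' → Coveredᴿ S X → Coveredᴿ S' X
  Coveredᴿ-≼ I (∈ᴿ p) = succ≼ I p
  Coveredᴿ-≼ I (∧ᴿ₁ a) = ∧ᴿ₁ (Coveredᴿ-≼ I a)
  Coveredᴿ-≼ I (∧ᴿ₂ a) = ∧ᴿ₂ (Coveredᴿ-≼ I a)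
  Coveredᴿ-≼ I (∨ᴿ a b) = ∨ᴿ (Coveredᴿ-≼ I a) (Coveredᴿ-≼ I b)
  Coveredᴿ-≼ I (⇒ᴿ e a b) = ⇒ᴿ (rel⊆ I e) (Coveredᴸ-≼ I a) (Coveredᴿ-≼ I b)
  Coveredᴿ-≼ I (∀ᴿ e f a) = ∀ᴿ (rel⊆ I e) (dom⊆ I f) (Coveredᴿ-≼ I a)

↭-Coveredᴸ : Γ ↭ X ∷ Γ' → Coveredᴸ S X → Γ' ⊆ Sequent.ante S → ∀ {Y} → Y ∈ Γ → Coveredᴸ S Y
↭-Coveredᴸ pm c Γ'⊆ Y∈Γ with ∈-resp-↭ pm Y∈Γ
... | here refl = c
... | there Y∈Γ' = ∈ᴸ (Γ'⊆ Y∈Γ')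

↭-Coveredᴿ : Δ ↭ X ∷ Δ' → Coveredᴿ S X → Δ' ⊆ Sequent.succ S → ∀ {Y} → Y ∈ Δ → Coveredᴿ S Y
↭-Coveredᴿ pm c Δ'⊆ Y∈Δ with ∈-resp-↭ pm Y∈Δ
... | here refl = c
... | there Y∈Δ' = ∈ᴿ (Δ'⊆ Y∈Δ')

≼-ante∷ : (R ∣ T ∣ Γ ⊢ Δ) ≼ (R ∣ T ∣ X ∷ Γ ⊢ Δ)
≼-ante∷ = record { rel⊆ = id ; dom⊆ = id ; ante≼ = ∈ᴸ ∘ there ; succ≼ = ∈ᴿ }

≼-succ∷ : (R ∣ T ∣ Γ ⊢ Δ) ≼ (R ∣ T ∣ Γ ⊢ X ∷ Δ)
≼-succ∷ = record { rel⊆ = id ; dom⊆ = id ; ante≼ = ∈ᴸ ; succ≼ = ∈ᴿ ∘ there }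

≼-dom++ : (R ∣ T ∣ Γ ⊢ Δ) ≼ (R ∣ T' ++ T ∣ Γ ⊢ Δ)
≼-dom++ {T' = T'} = record { rel⊆ = id ; dom⊆ = ∈-++⁺ʳ T' ; ante≼ = ∈ᴸ ; succ≼ = ∈ᴿ }

≼-contractᴸ : (R ∣ T ∣ X ∷ X ∷ Γ ⊢ Δ) ≼ (R ∣ T ∣ X ∷ Γ ⊢ Δ)
≼-contractᴸ = record
  { rel⊆ = id ; dom⊆ = id ; succ≼ = ∈ᴿ
  ; ante≼ = λ { (here e) → ∈ᴸ (here e) ; (there p) → ∈ᴸ p } }

≼-contractᴿ : (R ∣ T ∣ Γ ⊢ X ∷ X ∷ Δ) ≼ (R ∣ T ∣ Γ ⊢ X ∷ Δ)
≼-contractᴿ = record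
  { rel⊆ = id ; dom⊆ = id ; ante≼ = ∈ᴸ
  ; succ≼ = λ { (here e) → ∈ᴿ (here e) ; (there p) → ∈ᴿ p } }

≼-∧L : Γ ↭ (w , φ ∧ᶠ ψ) ∷ Γ' → (R ∣ T ∣ Γ ⊢ Δ) ≼ (R ∣ T ∣ (w , φ) ∷ (w , ψ) ∷ Γ' ⊢ Δ)
≼-∧L pm = record
  { rel⊆ = id ; dom⊆ = id ; succ≼ = ∈ᴿ
  ; ante≼ = ↭-Coveredᴸ pm (∧ᴸ (∈ᴸ (here refl)) (∈ᴸ (there (here refl)))) (there ∘ there) }

≼-∧R₁ : Δ ↭ (w , φ ∧ᶠ ψ) ∷ Δ' → (R ∣ T ∣ Γ ⊢ Δ) ≼ (R ∣ T ∣ Γ ⊢ (w , φ) ∷ Δ')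
≼-∧R₁ pm = record { rel⊆ = id ; dom⊆ = id ; ante≼ = ∈ᴸ ; succ≼ = ↭-Coveredᴿ pm (∧ᴿ₁ (∈ᴿ (here refl))) there }

≼-∧R₂ : Δ ↭ (w , φ ∧ᶠ ψ) ∷ Δ' → (R ∣ T ∣ Γ ⊢ Δ) ≼ (R ∣ T ∣ Γ ⊢ (w , ψ) ∷ Δ')
≼-∧R₂ pm = record { rel⊆ = id ; dom⊆ = id ; ante≼ = ∈ᴸ ; succ≼ = ↭-Coveredᴿ pm (∧ᴿ₂ (∈ᴿ (here refl))) there }

≼-∨L₁ : Γ ↭ (w , φ ∨ᶠ ψ) ∷ Γ' → (R ∣ T ∣ Γ ⊢ Δ) ≼ (R ∣ T ∣ (w , φ) ∷ Γ' ⊢ Δ)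
≼-∨L₁ pm = record { rel⊆ = id ; dom⊆ = id ; ante≼ = ↭-Coveredᴸ pm (∨ᴸ₁ (∈ᴸ (here refl))) there ; succ≼ = ∈ᴿ }

≼-∨L₂ : Γ ↭ (w , φ ∨ᶠ ψ) ∷ Γ' → (R ∣ T ∣ Γ ⊢ Δ) ≼ (R ∣ T ∣ (w , ψ) ∷ Γ' ⊢ Δ)
≼-∨L₂ pm = record { rel⊆ = id ; dom⊆ = id ; ante≼ = ↭-Coveredᴸ pm (∨ᴸ₂ (∈ᴸ (here refl))) there ; succ≼ = ∈ᴿ }

≼-∨R : Δ ↭ (w , φ ∨ᶠ ψ) ∷ Δ' → (R ∣ T ∣ Γ ⊢ Δ) ≼ (R ∣ T ∣ Γ ⊢ (w , φ) ∷ (w , ψ) ∷ Δ')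
≼-∨R pm = record
  { rel⊆ = id ; dom⊆ = id ; ante≼ = ∈ᴸ
  ; succ≼ = ↭-Coveredᴿ pm (∨ᴿ (∈ᴿ (here refl)) (∈ᴿ (there (here refl)))) (there ∘ there) }

≼-⇒R : Δ ↭ (w , φ ⇒ ψ) ∷ Δ' → (R ∣ T ∣ Γ ⊢ Δ) ≼ ((w , u) ∷ R ∣ T ∣ (u , φ) ∷ Γ ⊢ (u , ψ) ∷ Δ')
≼-⇒R pm = record
  { rel⊆ = there ; dom⊆ = id ; ante≼ = ∈ᴸ ∘ there
  ; succ≼ = ↭-Coveredᴿ pm (⇒ᴿ (here refl) (∈ᴸ (here refl)) (∈ᴿ (here refl))) there }

≼-−<L : Γ ↭ (w , φ −< ψ) ∷ Γ' → (R ∣ T ∣ Γ ⊢ Δ) ≼ ((u , w) ∷ R ∣ T ∣ (u , φ) ∷ Γ' ⊢ (u , ψ) ∷ Δ)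
≼-−<L pm = record
  { rel⊆ = there ; dom⊆ = id ; succ≼ = ∈ᴿ ∘ there
  ; ante≼ = ↭-Coveredᴸ pm (−<ᴸ (here refl) (∈ᴸ (here refl)) (∈ᴿ (here refl))) there }

≼-∃L : ∀ {φ} → Γ ↭ (w , ∃ᶠ φ) ∷ Γ' → (R ∣ T ∣ Γ ⊢ Δ) ≼ (R ∣ (w , y) ∷ T ∣ (w , inst (var y) φ) ∷ Γ' ⊢ Δ)
≼-∃L pm = record
  { rel⊆ = id ; dom⊆ = there ; succ≼ = ∈ᴿ
  ; ante≼ = ↭-Coveredᴸ pm (∃ᴸ (here refl) (∈ᴸ (here refl))) there }

≼-∀R : ∀ {φ} → Δ ↭ (w , ∀ᶠ φ) ∷ Δ' →
       (R ∣ T ∣ Γ ⊢ Δ) ≼ ((w , u) ∷ R ∣ (u , y) ∷ T ∣ Γ ⊢ (u , inst (var y) φ) ∷ Δ')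
≼-∀R pm = record
  { rel⊆ = there ; dom⊆ = there ; ante≼ = ∈ᴸ
  ; succ≼ = ↭-Coveredᴿ pm (∀ᴿ (here refl) (here refl) (∈ᴿ (here refl))) there }

record Simulation (σ : Label → Label) (τ : Var → Var) (S S₂ : Sequent) : Set where
  field
    rel↦  : ∀ {a b} → (a , b) ∈ Sequent.rel S → (σ a , σ b) ∈ Sequent.rel S₂
    dom↦  : ∀ {l x} → (l , x) ∈ Sequent.dom S → (σ l , τ x) ∈ Sequent.dom S₂
    ante↦ : ∀ {l φ} → (l , φ) ∈ Sequent.ante S → Coveredᴸ S₂ (σ l , rename τ φ)
    succ↦ : ∀ {l φ} → (l , φ) ∈ Sequent.succ S → Coveredᴿ S₂ (σ l , rename τ φ)
open Simulation

≼⇒Simulation : S ≼ S' → Simulation id id S S'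
≼⇒Simulation I = record
  { rel↦ = rel⊆ I ; dom↦ = dom⊆ I
  ; ante↦ = λ {l} {φ} p → subst (λ φ' → Coveredᴸ _ (l , φ')) (sym (rename-id φ)) (ante≼ I p)
  ; succ↦ = λ {l} {φ} p → subst (λ φ' → Coveredᴿ _ (l , φ')) (sym (rename-id φ)) (succ≼ I p) }

Simulation-≼ : S₂ ≼ S₃ → Simulation σ τ S S₂ → Simulation σ τ S S₃
Simulation-≼ I s = record
  { rel↦ = rel⊆ I ∘ rel↦ s ; dom↦ = dom⊆ I ∘ dom↦ s
  ; ante↦ = Coveredᴸ-≼ I ∘ ante↦ s ; succ↦ = Coveredᴿ-≼ I ∘ succ↦ s }

Simulation-agree : (∀ {l} → l ∈ labels S → σ l ≡ σ' l) → (∀ {x} → x ∈ vars S → τ x ≡ τ' x) →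
                   Simulation σ τ S S₂ → Simulation σ' τ' S S₂
Simulation-agree {S = S} {S₂ = S₂} eqσ eqτ s = record
  { rel↦ = λ p → subst₂ (λ a b → (a , b) ∈ Sequent.rel S₂)
      (eqσ (rel-labelˡ S p)) (eqσ (rel-labelʳ S p)) (rel↦ s p)
  ; dom↦ = λ p → subst₂ (λ l x → (l , x) ∈ Sequent.dom S₂)
      (eqσ (dom-label S p)) (eqτ (dom-var S p)) (dom↦ s p)
  ; ante↦ = λ {_} {φ} p → subst (Coveredᴸ S₂)
      (cong₂ _,_ (eqσ (ante-label S p)) (rename-cong φ (eqτ ∘ ante-var S p))) (ante↦ s p)
  ; succ↦ = λ {_} {φ} p → subst (Coveredᴿ S₂)
      (cong₂ _,_ (eqσ (succ-label S p)) (rename-cong φ (eqτ ∘ succ-var S p))) (succ↦ s p) }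

Simulation-[↦]ˡ : u ∉ labels S → Simulation σ τ S S₂ → Simulation (σ [ u ↦ v ]) τ S S₂
Simulation-[↦]ˡ {σ = σ} {v = v} u∉S = Simulation-agree (λ l∈S → sym ([↦]-≢ σ v (∈∧∉⇒≢ l∈S u∉S))) (λ _ → refl)

Simulation-[↦]ᵛ : y ∉ vars S → Simulation σ τ S S₂ → Simulation σ (τ [ y ↦ z ]) S S₂
Simulation-[↦]ᵛ {τ = τ} {z = z} y∉S = Simulation-agree (λ _ → refl) (λ x∈S → sym ([↦]-≢ τ z (∈∧∉⇒≢ x∈S y∉S)))

Simulation-rel∷ : (σ w , σ u) ∈ Sequent.rel S₂ →
                  Simulation σ τ (R ∣ T ∣ Γ ⊢ Δ) S₂ → Simulation σ τ ((w , u) ∷ R ∣ T ∣ Γ ⊢ Δ) S₂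
Simulation-rel∷ e s = record
  { rel↦ = λ { (here refl) → e ; (there p) → rel↦ s p }
  ; dom↦ = dom↦ s ; ante↦ = ante↦ s ; succ↦ = succ↦ s }

Simulation-dom++ : (∀ {l x} → (l , x) ∈ T' → (σ l , τ x) ∈ Sequent.dom S₂) →
                   Simulation σ τ (R ∣ T ∣ Γ ⊢ Δ) S₂ → Simulation σ τ (R ∣ T' ++ T ∣ Γ ⊢ Δ) S₂
Simulation-dom++ {T' = T'} e s = record
  { dom↦ = λ p → [ e , dom↦ s ]′ (∈-++⁻ T' p)
  ; rel↦ = rel↦ s ; ante↦ = ante↦ s ; succ↦ = succ↦ s }

Simulation-dom∷ : (σ w , τ y) ∈ Sequent.dom S₂ →
                  Simulation σ τ (R ∣ T ∣ Γ ⊢ Δ) S₂ → Simulation σ τ (R ∣ (w , y) ∷ T ∣ Γ ⊢ Δ) S₂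
Simulation-dom∷ e = Simulation-dom++ λ { (here refl) → e }

Simulation-ante∷ : ∀ {φ} → Coveredᴸ S₂ (σ w , rename τ φ) →
                   Simulation σ τ (R ∣ T ∣ Γ ⊢ Δ) S₂ → Simulation σ τ (R ∣ T ∣ (w , φ) ∷ Γ ⊢ Δ) S₂
Simulation-ante∷ c s = record
  { ante↦ = λ { (here refl) → c ; (there p) → ante↦ s p }
  ; rel↦ = rel↦ s ; dom↦ = dom↦ s ; succ↦ = succ↦ s }

Simulation-succ∷ : ∀ {φ} → Coveredᴿ S₂ (σ w , rename τ φ) →
                   Simulation σ τ (R ∣ T ∣ Γ ⊢ Δ) S₂ → Simulation σ τ (R ∣ T ∣ Γ ⊢ (w , φ) ∷ Δ) S₂
Simulation-succ∷ c s = record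
  { succ↦ = λ { (here refl) → c ; (there p) → succ↦ s p }
  ; rel↦ = rel↦ s ; dom↦ = dom↦ s ; ante↦ = ante↦ s }

Simulation-ante↭ : Γ ↭ X ∷ Γ' → Simulation σ τ (R ∣ T ∣ Γ ⊢ Δ) S₂ → Simulation σ τ (R ∣ T ∣ Γ' ⊢ Δ) S₂
Simulation-ante↭ pm s = record
  { ante↦ = ante↦ s ∘ ∈-resp-↭ (↭-sym pm) ∘ there
  ; rel↦ = rel↦ s ; dom↦ = dom↦ s ; succ↦ = succ↦ s }

Simulation-succ↭ : Δ ↭ X ∷ Δ' → Simulation σ τ (R ∣ T ∣ Γ ⊢ Δ) S₂ → Simulation σ τ (R ∣ T ∣ Γ ⊢ Δ') S₂
Simulation-succ↭ pm s = record
  { succ↦ = succ↦ s ∘ ∈-resp-↭ (↭-sym pm) ∘ there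
  ; rel↦ = rel↦ s ; dom↦ = dom↦ s ; ante↦ = ante↦ s }

Simulation-⇒R : Δ ↭ (w , φ ⇒ ψ) ∷ Δ' → u ∉ labels (R ∣ T ∣ Γ ⊢ Δ) →
                (σ w , v) ∈ Sequent.rel S₂ → Coveredᴸ S₂ (v , rename τ φ) → Coveredᴿ S₂ (v , rename τ ψ) →
                Simulation σ τ (R ∣ T ∣ Γ ⊢ Δ) S₂ →
                Simulation (σ [ u ↦ v ]) τ ((w , u) ∷ R ∣ T ∣ (u , φ) ∷ Γ ⊢ (u , ψ) ∷ Δ') S₂
Simulation-⇒R {Δ = Δ} {w = w} {u = u} {R = R} {T = T} {Γ = Γ} {σ = σ} {v = v} {S₂ = S₂} pm u∉S e c₁ c₂ s =
  Simulation-rel∷ (subst (_∈ Sequent.rel S₂) (sym (cong₂ _,_ σ'w σ'u)) e)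
    (Simulation-ante∷ (subst (Coveredᴸ S₂) (sym (cong (_, _) σ'u)) c₁)
      (Simulation-succ∷ (subst (Coveredᴿ S₂) (sym (cong (_, _) σ'u)) c₂)
        (Simulation-succ↭ pm (Simulation-[↦]ˡ u∉S s))))
  where
  σ'u : (σ [ u ↦ v ]) u ≡ v
  σ'u = [↦]-≡ σ u v
  σ'w : (σ [ u ↦ v ]) w ≡ σ w
  σ'w = [↦]-≢ σ v (∈∧∉⇒≢ (succ-label (R ∣ T ∣ Γ ⊢ Δ) (↭-head pm)) u∉S)

Simulation-−<L : Γ ↭ (w , φ −< ψ) ∷ Γ' → u ∉ labels (R ∣ T ∣ Γ ⊢ Δ) →
                 (v , σ w) ∈ Sequent.rel S₂ → Coveredᴸ S₂ (v , rename τ φ) → Coveredᴿ S₂ (v , rename τ ψ) →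
                 Simulation σ τ (R ∣ T ∣ Γ ⊢ Δ) S₂ →
                 Simulation (σ [ u ↦ v ]) τ ((u , w) ∷ R ∣ T ∣ (u , φ) ∷ Γ' ⊢ (u , ψ) ∷ Δ) S₂
Simulation-−<L {Γ = Γ} {w = w} {u = u} {R = R} {T = T} {Δ = Δ} {v = v} {σ = σ} {S₂ = S₂} pm u∉S e c₁ c₂ s =
  Simulation-rel∷ (subst (_∈ Sequent.rel S₂) (sym (cong₂ _,_ σ'u σ'w)) e)
    (Simulation-ante∷ (subst (Coveredᴸ S₂) (sym (cong (_, _) σ'u)) c₁)
      (Simulation-succ∷ (subst (Coveredᴿ S₂) (sym (cong (_, _) σ'u)) c₂)
        (Simulation-ante↭ pm (Simulation-[↦]ˡ u∉S s))))
  where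
  σ'u : (σ [ u ↦ v ]) u ≡ v
  σ'u = [↦]-≡ σ u v
  σ'w : (σ [ u ↦ v ]) w ≡ σ w
  σ'w = [↦]-≢ σ v (∈∧∉⇒≢ (ante-label (R ∣ T ∣ Γ ⊢ Δ) (↭-head pm)) u∉S)

Simulation-∃L : ∀ {φ} → Γ ↭ (w , ∃ᶠ φ) ∷ Γ' → y ∉ vars (R ∣ T ∣ Γ ⊢ Δ) →
                (σ w , z) ∈ Sequent.dom S₂ → Coveredᴸ S₂ (σ w , inst (var z) (rename τ φ)) →
                Simulation σ τ (R ∣ T ∣ Γ ⊢ Δ) S₂ →
                Simulation σ (τ [ y ↦ z ]) (R ∣ (w , y) ∷ T ∣ (w , inst (var y) φ) ∷ Γ' ⊢ Δ) S₂
Simulation-∃L {Γ = Γ} {w = w} {y = y} {R = R} {T = T} {Δ = Δ} {σ = σ} {z = z} {S₂ = S₂} {τ = τ} {φ = φ}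
              pm y∉S e c s =
  Simulation-dom∷ (subst (λ x → (σ w , x) ∈ Sequent.dom S₂) (sym ([↦]-≡ τ y z)) e)
    (Simulation-ante∷ (subst (λ φ' → Coveredᴸ S₂ (σ w , φ')) (sym (rename-inst-[↦] φ y∉φ)) c)
      (Simulation-ante↭ pm (Simulation-[↦]ᵛ y∉S s)))
  where
  y∉φ : y ∉ fvF φ
  y∉φ = y∉S ∘ ante-var (R ∣ T ∣ Γ ⊢ Δ) (↭-head pm)

Simulation-∀R : ∀ {φ} → Δ ↭ (w , ∀ᶠ φ) ∷ Δ' → u ∉ labels (R ∣ T ∣ Γ ⊢ Δ) → y ∉ vars (R ∣ T ∣ Γ ⊢ Δ) →
                (σ w , v) ∈ Sequent.rel S₂ → (v , z) ∈ Sequent.dom S₂ →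
                Coveredᴿ S₂ (v , inst (var z) (rename τ φ)) →
                Simulation σ τ (R ∣ T ∣ Γ ⊢ Δ) S₂ →
                Simulation (σ [ u ↦ v ]) (τ [ y ↦ z ])
                           ((w , u) ∷ R ∣ (u , y) ∷ T ∣ Γ ⊢ (u , inst (var y) φ) ∷ Δ') S₂
Simulation-∀R {Δ = Δ} {w = w} {u = u} {R = R} {T = T} {Γ = Γ} {y = y} {σ = σ} {v = v} {S₂ = S₂} {z = z}
              {τ = τ} {φ = φ} pm u∉S y∉S e f c s =
  Simulation-rel∷ (subst (_∈ Sequent.rel S₂) (sym (cong₂ _,_ σ'w σ'u)) e)
    (Simulation-dom∷ (subst (_∈ Sequent.dom S₂) (sym (cong₂ _,_ σ'u ([↦]-≡ τ y z))) f)
      (Simulation-succ∷ (subst (Coveredᴿ S₂) (sym (cong₂ _,_ σ'u (rename-inst-[↦] φ y∉φ))) c)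
        (Simulation-succ↭ pm (Simulation-[↦]ᵛ y∉S (Simulation-[↦]ˡ u∉S s)))))
  where
  σ'u : (σ [ u ↦ v ]) u ≡ v
  σ'u = [↦]-≡ σ u v
  σ'w : (σ [ u ↦ v ]) w ≡ σ w
  σ'w = [↦]-≢ σ v (∈∧∉⇒≢ (succ-label (R ∣ T ∣ Γ ⊢ Δ) (↭-head pm)) u∉S)
  y∉φ : y ∉ fvF φ
  y∉φ = y∉S ∘ succ-var (R ∣ T ∣ Γ ⊢ Δ) (↭-head pm)

Reach-map : (∀ {a b} → (a , b) ∈ R → (σ a , σ b) ∈ R₂) → Reach R w u → Reach R₂ (σ w) (σ u)
Reach-map f here = here
Reach-map f (step e r) = step (f e) (Reach-map f r)

TermOK-rename : ∀ C {t} → Simulation σ τ (R ∣ T ∣ Γ ⊢ Δ) S₂ → TermOK C R T t w →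
                TermOK C (Sequent.rel S₂) (Sequent.dom S₂) (renameᵗ τ t) (σ w)
TermOK-rename ID {t} s ok =
  subst (All _) (sym (fvT-renameᵗ _ t))
        (map⁺ (All.map (λ (u , m , r) → _ , dom↦ s m , Reach-map (rel↦ s) r) ok))
TermOK-rename CD s _ = tt

Simulable : Cond → Sequent → ℕ → Set
Simulable C S n = ∀ {σ τ S₂} → Simulation σ τ S S₂ → Σ[ d ∈ Der C S₂ ] height d ≤ n

Simulable-≤ : m ≤ n → Simulable C S m → Simulable C S n
Simulable-≤ m≤n sim s = let d , h = sim s in d , ≤-trans h m≤n

ax-simulable : ∀ {p ts} → (w , atom p ts) ∈ Γ → (u , atom p ts) ∈ Δ → Reach R w u →
               Simulable C (R ∣ T ∣ Γ ⊢ Δ) 0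
ax-simulable m₁ m₂ r s with ante↦ s m₁ | succ↦ s m₂
... | ∈ᴸ m₁' | ∈ᴿ m₂' = ax m₁' m₂' (Reach-map (rel↦ s) r) , z≤n

⊥L-simulable : (w , ⊥ᶠ) ∈ Γ → Simulable C (R ∣ T ∣ Γ ⊢ Δ) 0
⊥L-simulable m s with ante↦ s m
... | ∈ᴸ m' = ⊥L m' , z≤n

⊤R-simulable : (w , ⊤ᶠ) ∈ Δ → Simulable C (R ∣ T ∣ Γ ⊢ Δ) 0
⊤R-simulable m s with succ↦ s m
... | ∈ᴿ m' = ⊤R m' , z≤n

private
  ≤-sucˡ : ∀ m n → m ≤ suc (m ⊔ n)
  ≤-sucˡ m n = m≤n⇒m≤1+n (m≤m⊔n m n)

  ≤-sucʳ : ∀ m n → n ≤ suc (m ⊔ n)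
  ≤-sucʳ m n = m≤n⇒m≤1+n (m≤n⊔m m n)

∧L-simulable : Γ ↭ (w , φ ∧ᶠ ψ) ∷ Γ' → Simulable C (R ∣ T ∣ (w , φ) ∷ (w , ψ) ∷ Γ' ⊢ Δ) n →
               Simulable C (R ∣ T ∣ Γ ⊢ Δ) (suc n)
∧L-simulable pm ih s with ante↦ s (↭-head pm)
... | ∈ᴸ m =
  let _ , pm₂ = ∈⇒↭ m
      d , h = ih (Simulation-ante∷ (∈ᴸ (here refl)) (Simulation-ante∷ (∈ᴸ (there (here refl)))
                 (Simulation-ante↭ pm (Simulation-≼ (≼-∧L pm₂) s))))
  in ∧L pm₂ d , s≤s h
... | ∧ᴸ c₁ c₂ = Simulable-≤ (n≤1+n _) ih (Simulation-ante∷ c₁ (Simulation-ante∷ c₂ (Simulation-ante↭ pm s)))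

∧R-simulable : Δ ↭ (w , φ ∧ᶠ ψ) ∷ Δ' →
               Simulable C (R ∣ T ∣ Γ ⊢ (w , φ) ∷ Δ') m → Simulable C (R ∣ T ∣ Γ ⊢ (w , ψ) ∷ Δ') n →
               Simulable C (R ∣ T ∣ Γ ⊢ Δ) (suc (m ⊔ n))
∧R-simulable pm ih₁ ih₂ s with succ↦ s (↭-head pm)
... | ∈ᴿ e =
  let _ , pm₂ = ∈⇒↭ e
      d₁ , h₁ = ih₁ (Simulation-succ∷ (∈ᴿ (here refl)) (Simulation-succ↭ pm (Simulation-≼ (≼-∧R₁ pm₂) s)))
      d₂ , h₂ = ih₂ (Simulation-succ∷ (∈ᴿ (here refl)) (Simulation-succ↭ pm (Simulation-≼ (≼-∧R₂ pm₂) s)))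
  in ∧R pm₂ d₁ d₂ , s≤s (⊔-mono-≤ h₁ h₂)
∧R-simulable {m = m} {n = n} pm ih₁ ih₂ s | ∧ᴿ₁ c =
  Simulable-≤ (≤-sucˡ m n) ih₁ (Simulation-succ∷ c (Simulation-succ↭ pm s))
∧R-simulable {m = m} {n = n} pm ih₁ ih₂ s | ∧ᴿ₂ c =
  Simulable-≤ (≤-sucʳ m n) ih₂ (Simulation-succ∷ c (Simulation-succ↭ pm s))

∨L-simulable : Γ ↭ (w , φ ∨ᶠ ψ) ∷ Γ' →
               Simulable C (R ∣ T ∣ (w , φ) ∷ Γ' ⊢ Δ) m → Simulable C (R ∣ T ∣ (w , ψ) ∷ Γ' ⊢ Δ) n →
               Simulable C (R ∣ T ∣ Γ ⊢ Δ) (suc (m ⊔ n))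
∨L-simulable pm ih₁ ih₂ s with ante↦ s (↭-head pm)
... | ∈ᴸ e =
  let _ , pm₂ = ∈⇒↭ e
      d₁ , h₁ = ih₁ (Simulation-ante∷ (∈ᴸ (here refl)) (Simulation-ante↭ pm (Simulation-≼ (≼-∨L₁ pm₂) s)))
      d₂ , h₂ = ih₂ (Simulation-ante∷ (∈ᴸ (here refl)) (Simulation-ante↭ pm (Simulation-≼ (≼-∨L₂ pm₂) s)))
  in ∨L pm₂ d₁ d₂ , s≤s (⊔-mono-≤ h₁ h₂)
∨L-simulable {m = m} {n = n} pm ih₁ ih₂ s | ∨ᴸ₁ c =
  Simulable-≤ (≤-sucˡ m n) ih₁ (Simulation-ante∷ c (Simulation-ante↭ pm s))
∨L-simulable {m = m} {n = n} pm ih₁ ih₂ s | ∨ᴸ₂ c =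
  Simulable-≤ (≤-sucʳ m n) ih₂ (Simulation-ante∷ c (Simulation-ante↭ pm s))

∨R-simulable : Δ ↭ (w , φ ∨ᶠ ψ) ∷ Δ' → Simulable C (R ∣ T ∣ Γ ⊢ (w , φ) ∷ (w , ψ) ∷ Δ') n →
               Simulable C (R ∣ T ∣ Γ ⊢ Δ) (suc n)
∨R-simulable pm ih s with succ↦ s (↭-head pm)
... | ∈ᴿ e =
  let _ , pm₂ = ∈⇒↭ e
      d , h = ih (Simulation-succ∷ (∈ᴿ (here refl)) (Simulation-succ∷ (∈ᴿ (there (here refl)))
                 (Simulation-succ↭ pm (Simulation-≼ (≼-∨R pm₂) s))))
  in ∨R pm₂ d , s≤s h
... | ∨ᴿ c₁ c₂ = Simulable-≤ (n≤1+n _) ih (Simulation-succ∷ c₁ (Simulation-succ∷ c₂ (Simulation-succ↭ pm s)))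

⇒L-simulable : (w , φ ⇒ ψ) ∈ Γ → Reach R w u →
               Simulable C (R ∣ T ∣ Γ ⊢ (u , φ) ∷ Δ) m → Simulable C (R ∣ T ∣ (u , ψ) ∷ Γ ⊢ Δ) n →
               Simulable C (R ∣ T ∣ Γ ⊢ Δ) (suc (m ⊔ n))
⇒L-simulable p r ih₁ ih₂ s with ante↦ s p
... | ∈ᴸ p' =
  let d₁ , h₁ = ih₁ (Simulation-succ∷ (∈ᴿ (here refl)) (Simulation-≼ ≼-succ∷ s))
      d₂ , h₂ = ih₂ (Simulation-ante∷ (∈ᴸ (here refl)) (Simulation-≼ ≼-ante∷ s))
  in ⇒L p' (Reach-map (rel↦ s) r) d₁ d₂ , s≤s (⊔-mono-≤ h₁ h₂)

−<R-simulable : (u , φ −< ψ) ∈ Δ → Reach R w u →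
                Simulable C (R ∣ T ∣ Γ ⊢ (w , φ) ∷ Δ) m → Simulable C (R ∣ T ∣ (w , ψ) ∷ Γ ⊢ Δ) n →
                Simulable C (R ∣ T ∣ Γ ⊢ Δ) (suc (m ⊔ n))
−<R-simulable p r ih₁ ih₂ s with succ↦ s p
... | ∈ᴿ p' =
  let d₁ , h₁ = ih₁ (Simulation-succ∷ (∈ᴿ (here refl)) (Simulation-≼ ≼-succ∷ s))
      d₂ , h₂ = ih₂ (Simulation-ante∷ (∈ᴸ (here refl)) (Simulation-≼ ≼-ante∷ s))
  in −<R p' (Reach-map (rel↦ s) r) d₁ d₂ , s≤s (⊔-mono-≤ h₁ h₂)

∃R-simulable : ∀ {C φ} t → (w , ∃ᶠ φ) ∈ Δ → TermOK C R T t w →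
               Simulable C (R ∣ T ∣ Γ ⊢ (w , inst t φ) ∷ Δ) n → Simulable C (R ∣ T ∣ Γ ⊢ Δ) (suc n)
∃R-simulable {C = C} {φ = φ} t p ok ih {τ = τ} s with succ↦ s p
... | ∈ᴿ p' =
  let d , h = ih (Simulation-succ∷ (∈ᴿ (here (cong (_ ,_) (rename-inst τ t φ)))) (Simulation-≼ ≼-succ∷ s))
  in ∃R (renameᵗ τ t) p' (TermOK-rename C s ok) d , s≤s h

∀L-simulable : ∀ {C φ} t → (w , ∀ᶠ φ) ∈ Γ → Reach R w u → TermOK C R T t u →
               Simulable C (R ∣ T ∣ (u , inst t φ) ∷ Γ ⊢ Δ) n → Simulable C (R ∣ T ∣ Γ ⊢ Δ) (suc n)
∀L-simulable {C = C} {φ = φ} t p r ok ih {τ = τ} s with ante↦ s p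
... | ∈ᴸ p' =
  let d , h = ih (Simulation-ante∷ (∈ᴸ (here (cong (_ ,_) (rename-inst τ t φ)))) (Simulation-≼ ≼-ante∷ s))
  in ∀L (renameᵗ τ t) p' (Reach-map (rel↦ s) r) (TermOK-rename C s ok) d , s≤s h

map-VT-rename : ∀ ts → (u , x) ∈ map (λ x → (w , x)) (VT ts) →
                (σ u , τ x) ∈ map (λ x → (σ w , x)) (VT (renameᵗˢ τ ts))
map-VT-rename ts q with ∈-map⁻ _ q
... | _ , x∈VT , refl = ∈-map⁺ _ (VT-rename ts x∈VT)

ds-simulable : ∀ {p ts} → C ≡ ID → (w , atom p ts) ∈ Γ →
               Simulable C (R ∣ map (λ x → (w , x)) (VT ts) ++ T ∣ Γ ⊢ Δ) n →
               Simulable C (R ∣ T ∣ Γ ⊢ Δ) (suc n)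
ds-simulable {ts = ts} eq p ih s with ante↦ s p
... | ∈ᴸ p' =
  let d , h = ih (Simulation-dom++ (∈-++⁺ˡ ∘ map-VT-rename ts) (Simulation-≼ ≼-dom++ s))
  in ds eq p' d , s≤s h

⇒R-simulable : Δ ↭ (w , φ ⇒ ψ) ∷ Δ' → u ∉ labels (R ∣ T ∣ Γ ⊢ Δ) →
               Simulable C ((w , u) ∷ R ∣ T ∣ (u , φ) ∷ Γ ⊢ (u , ψ) ∷ Δ') n →
               Simulable C (R ∣ T ∣ Γ ⊢ Δ) (suc n)
⇒R-simulable pm u∉S ih {S₂ = S₂} s with succ↦ s (↭-head pm)
... | ∈ᴿ p =
  let _ , pm₂ = ∈⇒↭ p
      d , h = ih (Simulation-⇒R pm u∉S (here refl) (∈ᴸ (here refl)) (∈ᴿ (here refl))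
                   (Simulation-≼ (≼-⇒R {u = fresh (labels S₂)} pm₂) s))
  in ⇒R pm₂ (fresh-∉ (labels S₂)) d , s≤s h
... | ⇒ᴿ e c₁ c₂ = Simulable-≤ (n≤1+n _) ih (Simulation-⇒R pm u∉S e c₁ c₂ s)

−<L-simulable : Γ ↭ (w , φ −< ψ) ∷ Γ' → u ∉ labels (R ∣ T ∣ Γ ⊢ Δ) →
                Simulable C ((u , w) ∷ R ∣ T ∣ (u , φ) ∷ Γ' ⊢ (u , ψ) ∷ Δ) n →
                Simulable C (R ∣ T ∣ Γ ⊢ Δ) (suc n)
−<L-simulable pm u∉S ih {S₂ = S₂} s with ante↦ s (↭-head pm)
... | ∈ᴸ p =
  let _ , pm₂ = ∈⇒↭ p
      d , h = ih (Simulation-−<L pm u∉S (here refl) (∈ᴸ (here refl)) (∈ᴿ (here refl))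
                   (Simulation-≼ (≼-−<L {u = fresh (labels S₂)} pm₂) s))
  in −<L pm₂ (fresh-∉ (labels S₂)) d , s≤s h
... | −<ᴸ e c₁ c₂ = Simulable-≤ (n≤1+n _) ih (Simulation-−<L pm u∉S e c₁ c₂ s)

∃L-simulable : ∀ {φ} → Γ ↭ (w , ∃ᶠ φ) ∷ Γ' → y ∉ vars (R ∣ T ∣ Γ ⊢ Δ) →
               Simulable C (R ∣ (w , y) ∷ T ∣ (w , inst (var y) φ) ∷ Γ' ⊢ Δ) n →
               Simulable C (R ∣ T ∣ Γ ⊢ Δ) (suc n)
∃L-simulable pm y∉S ih {S₂ = S₂} s with ante↦ s (↭-head pm)
... | ∈ᴸ p =
  let _ , pm₂ = ∈⇒↭ p
      d , h = ih (Simulation-∃L pm y∉S (here refl) (∈ᴸ (here refl))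
                   (Simulation-≼ (≼-∃L {y = fresh (vars S₂)} pm₂) s))
  in ∃L pm₂ (fresh-∉ (vars S₂)) d , s≤s h
... | ∃ᴸ e c = Simulable-≤ (n≤1+n _) ih (Simulation-∃L pm y∉S e c s)

∀R-simulable : ∀ {φ} → Δ ↭ (w , ∀ᶠ φ) ∷ Δ' → u ∉ labels (R ∣ T ∣ Γ ⊢ Δ) → y ∉ vars (R ∣ T ∣ Γ ⊢ Δ) →
               Simulable C ((w , u) ∷ R ∣ (u , y) ∷ T ∣ Γ ⊢ (u , inst (var y) φ) ∷ Δ') n →
               Simulable C (R ∣ T ∣ Γ ⊢ Δ) (suc n)
∀R-simulable pm u∉S y∉S ih {S₂ = S₂} s with succ↦ s (↭-head pm)
... | ∈ᴿ p =
  let _ , pm₂ = ∈⇒↭ p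
      d , h = ih (Simulation-∀R pm u∉S y∉S (here refl) (here refl) (∈ᴿ (here refl))
                   (Simulation-≼ (≼-∀R {u = fresh (labels S₂)} {y = fresh (vars S₂)} pm₂) s))
  in ∀R pm₂ (fresh-∉ (labels S₂)) (fresh-∉ (vars S₂)) d , s≤s h
... | ∀ᴿ e f c = Simulable-≤ (n≤1+n _) ih (Simulation-∀R pm u∉S y∉S e f c s)

simulate : (d : Der C S) → Simulable C S (height d)
simulate (ax p q r) = ax-simulable p q r
simulate (⊥L p) = ⊥L-simulable p
simulate (⊤R p) = ⊤R-simulable p
simulate (∧L pm d) = ∧L-simulable pm (simulate d)
simulate (∧R pm d e) = ∧R-simulable pm (simulate d) (simulate e)
simulate (∨L pm d e) = ∨L-simulable pm (simulate d) (simulate e)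
simulate (∨R pm d) = ∨R-simulable pm (simulate d)
simulate (⇒L p r d e) = ⇒L-simulable p r (simulate d) (simulate e)
simulate (⇒R pm fr d) = ⇒R-simulable pm fr (simulate d)
simulate (−<L pm fr d) = −<L-simulable pm fr (simulate d)
simulate (−<R p r d e) = −<R-simulable p r (simulate d) (simulate e)
simulate (∃L pm fr d) = ∃L-simulable pm fr (simulate d)
simulate (∃R t p ok d) = ∃R-simulable t p ok (simulate d)
simulate (∀L t p r ok d) = ∀L-simulable t p r ok (simulate d)
simulate (∀R pm frL frV d) = ∀R-simulable pm frL frV (simulate d)
simulate (ds eq p d) = ds-simulable eq p (simulate d)

≼-admissible : S ≼ S' → (d : Der C S) → Σ[ d' ∈ Der C S' ] height d' ≤ height d
≼-admissible I d = simulate d (≼⇒Simulation I)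

lemma43 : (C : Cond) (R : RelAtoms) (T : DomAtoms) (Γ Δ : List LForm) (w : Label) (φ : Form 0)
    → ((n : ℕ) → WF (R ∣ T ∣ (w , φ) ∷ (w , φ) ∷ Γ ⊢ Δ)
         → (d : Der C (R ∣ T ∣ (w , φ) ∷ (w , φ) ∷ Γ ⊢ Δ)) → height d ≡ n
         → Σ (Der C (R ∣ T ∣ (w , φ) ∷ Γ ⊢ Δ)) (λ d' → height d' ≤ n))
    × ((n : ℕ) → WF (R ∣ T ∣ Γ ⊢ (w , φ) ∷ (w , φ) ∷ Δ)
         → (d : Der C (R ∣ T ∣ Γ ⊢ (w , φ) ∷ (w , φ) ∷ Δ)) → height d ≡ n
         → Σ (Der C (R ∣ T ∣ Γ ⊢ (w , φ) ∷ Δ)) (λ d' → height d' ≤ n))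
lemma43 C R T Γ Δ w φ =
  (λ { _ _ d refl → ≼-admissible ≼-contractᴸ d }) ,
  (λ { _ _ d refl → ≼-admissible ≼-contractᴿ d })
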